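{- Let $\mathcal{L}=\{\ell_1,\ldots,\ell_m\}$ be a set of lines of $\mathrm{PG}(N,q)$ such that $S=\bigcup_{i=1}^m \ell_i$ is a cutting blocking set of $\mathrm{PG}(N,q)$, but for every $j\in\{1,\ldots,m\}$ the set $S_j=\bigcup_{i\neq j}\ell_i$ is not a cutting blocking set. Then for every $j\in\{1,\ldots,m\}$ there exists a subspace $\Lambda_j$ of co-dimension $2$ which intersects $\ell_i$ for each $i\in\{1,\ldots,m\}\setminus\{j\}$. Moreover, there exists a hyperplane $H_j\supseteq\Lambda_j$ such that the only lines of $\mathcal{L}\setminus\{\ell_j\}$ contained in $H_j$ are those contained in $\Lambda_j$.
   Context: $\mathrm{PG}(N,q)$ is the $N$-dimensional projective space over $\mathbb{F}_q$. A cutting blocking set of $\mathrm{PG}(N,q)$ is a point set $S$ such that for every hyperplane $H$, $S\cap H$ spans $H$. -}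

module Defs where

open import Level using (0ℓ)
open import Data.Nat using (ℕ; zero; suc; _∸_)
open import Data.Fin using (Fin; zero; suc)
open import Data.Product using (Σ; ∃; _×_; _,_)
open import Data.Sum using (_⊎_)
open import Relation.Nullary using (¬_)
open import Relation.Binary.PropositionalEquality using (_≡_)
open import Function.Bundles using (_↔_)
open import Algebra.Structures using (IsCommutativeRing)

record FiniteField : Set₁ where
  infixl 6 _+_
  infixl 7 _*_
  field
    Carrier : Set
    _+_ _*_ : Carrier → Carrier → Carrier
    -_      : Carrier → Carrier
    0# 1#   : Carrier
    isCommutativeRing : IsCommutativeRing _≡_ _+_ _*_ -_ 0# 1#
    0≢1     : ¬ (0# ≡ 1#)
    inverse : ∀ x → ¬ (x ≡ 0#) → Σ Carrier (λ y → x * y ≡ 1#)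
    q       : ℕ
    finite  : Fin q ↔ Carrier

-- Projective geometry PG(N, F), modelled through the vector space F^(N+1).
module PG (F : FiniteField) (N : ℕ) where
  open FiniteField F

  V : Set
  V = Fin (suc N) → Carrier

  _≈_ : V → V → Set
  u ≈ v = ∀ t → u t ≡ v t

  0v : V
  0v _ = 0#

  NonZero : V → Set
  NonZero v = ¬ (v ≈ 0v)

  lc : (k : ℕ) → (Fin k → Carrier) → (Fin k → V) → V
  lc zero    c b t = 0#
  lc (suc k) c b t = c zero * b zero t + lc k (λ i → c (suc i)) (λ i → b (suc i)) t

  LinIndep : (k : ℕ) → (Fin k → V) → Set
  LinIndep k b = ∀ c → lc k c b ≈ 0v → ∀ i → c i ≡ 0#

  InSpan : (V → Set) → V → Set
  InSpan P v = Σ ℕ λ k → Σ (Fin k → Carrier) λ c → Σ (Fin k → V) λ u →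
                 (∀ i → P (u i)) × (v ≈ lc k c u)

  -- A subspace of F^(N+1) of (vector) dimension k, i.e. a projective
  -- subspace of PG(N,q) of projective dimension k-1, given by a basis.
  record Subspace (k : ℕ) : Set where
    field
      basis : Fin k → V
      indep : LinIndep k basis

  _∈_ : ∀ {k} → V → Subspace k → Set
  v ∈ W = Σ (Fin _ → Carrier) λ c → v ≈ lc _ c (Subspace.basis W)

  _⊆_ : ∀ {k l} → Subspace k → Subspace l → Set
  W ⊆ W' = ∀ v → v ∈ W → v ∈ W'

  Meets : ∀ {k l} → Subspace k → Subspace l → Set
  Meets W W' = Σ V λ v → NonZero v × v ∈ W × v ∈ W'

  Line : Set
  Line = Subspace 2

  Hyperplane : Set
  Hyperplane = Subspace N

  Codim2 : Set
  Codim2 = Subspace (N ∸ 1)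

  -- A point set is a predicate on vectors (invariant under scaling when it
  -- comes from projective points).  S is cutting blocking iff for every
  -- hyperplane H, the points of S in H span H.
  CuttingBlocking : (V → Set) → Set
  CuttingBlocking S = ∀ (H : Hyperplane) → ∀ v → v ∈ H →
                        InSpan (λ w → S w × w ∈ H) v

  UnionOfLines : ∀ {m} → (Fin m → Line) → (Fin m → Set) → V → Set
  UnionOfLines ℓ I v = NonZero v × Σ (Fin _) λ i → I i × v ∈ ℓ i

-- If S_j is not cutting, some hyperplane H contains a point v outside the span
-- of S_j ∩ H. Extending a basis of ⟨S_j ∩ H⟩ first by v and then to a basis of H
-- and finally dropping v, one gets a subspace Λ ⊂ H of codimension two containing
-- S_j ∩ H. Every line meets the hyperplane H, hence meets Λ in a point of S_j ∩ H,
-- and a line ℓ_i ⊆ H (i ≠ j) consists of points of S_j ∩ H, so lies in Λ.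
-- Constructively H is found by exhaustive search, PG(N,q) being finite.

module Submission where

open import Level using (0ℓ)
open import Function using (_∘_; id)
open import Function.Bundles using (Inverse)
open import Function.Properties.Inverse using (↔-sym; ↔⇒↣)
open import Algebra.Bundles using (CommutativeRing)
open import Data.Nat using (ℕ; zero; suc; _∸_; _≤_; z≤n; s≤s)
import Data.Nat as Nat
open import Data.Nat.Properties using (≤-antisym; m≤n⇒m≤1+n; +-suc; 1+n≰n)
open import Data.Fin using (Fin; zero; suc)
import Data.Fin.Properties as Fin
open import Data.Product using (Σ; ∃; _×_; _,_; proj₁; proj₂)
open import Data.Sum using (_⊎_; inj₁; inj₂)
open import Data.Unit using (⊤; tt)
open import Data.Empty using (⊥-elim)
open import Data.List using (List; []; _∷_; _++_; length; map; tabulate; lookup; filter; cartesianProductWith; allFin)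
open import Data.List.Properties using (length-++; ++-identityʳ; tabulate-lookup; length-tabulate)
open import Data.List.Membership.Propositional using (find; lose) renaming (_∈_ to _∈ˡ_)
open import Data.List.Membership.Propositional.Properties
  using (∈-map⁺; ∈-allFin; ∈-++⁺ˡ; ∈-++⁺ʳ; ∈-++⁻; ∈-cartesianProductWith⁺; ∈-filter⁺; ∈-filter⁻; ∈-lookup)
open import Data.List.Relation.Binary.Subset.Propositional using () renaming (_⊆_ to _⊆ˡ_)
open import Data.List.Relation.Binary.Pointwise using (Pointwise; []; _∷_; Pointwise-length; symmetric)
open import Data.List.Relation.Unary.Any using (Any; here; there; any?)
open import Data.List.Relation.Unary.All as All using (All; []; _∷_; all?)
open import Data.List.Relation.Unary.All.Properties using (++⁺; ¬All⇒Any¬)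
import Data.Vec.Functional as Vector
open import Relation.Nullary using (¬_; Dec; yes; no; ¬?; contradiction)
open import Relation.Nullary.Decidable using (_×-dec_; map′; via-injection; decidable-stable)
open import Relation.Unary using (Decidable)
open import Relation.Binary.Definitions using (DecidableEquality)
open import Relation.Binary.PropositionalEquality
  using (_≡_; _≢_; _≗_; refl; sym; trans; cong; cong₂; subst; module ≡-Reasoning)

open import Defs

module FiniteFieldProperties (F : FiniteField) where
  open FiniteField F

  ring : CommutativeRing 0ℓ 0ℓ
  ring = record { isCommutativeRing = isCommutativeRing }

  open CommutativeRing ring public
    using (+-comm; +-assoc; +-identityˡ; +-identityʳ; *-identityˡ; *-identityʳ;
           *-assoc; *-comm; zeroˡ; zeroʳ; distribˡ; distribʳ; -‿inverseʳ)
  open import Algebra.Solver.Ring.NaturalCoefficients.Default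
    (CommutativeRing.commutativeSemiring ring)
  open ≡-Reasoning

  _≟_ : DecidableEquality Carrier
  _≟_ = via-injection (↔⇒↣ (↔-sym finite)) Fin._≟_

  open Inverse finite using (to; from; strictlyInverseˡ)

  elements : List Carrier
  elements = map to (allFin q)

  ∈-elements : ∀ a → a ∈ˡ elements
  ∈-elements a = subst (_∈ˡ elements) (strictlyInverseˡ a) (∈-map⁺ to (∈-allFin (from a)))

  ∃? : {P : Carrier → Set} → Decidable P → Dec (∃ P)
  ∃? P? = map′ (λ p → let (a , _ , pa) = find p in a , pa)
               (λ (a , pa) → lose (∈-elements a) pa)
               (any? P? elements)

  -1≢0 : - 1# ≢ 0#
  -1≢0 -1≡0 = 0≢1 (sym (begin
    1#          ≡⟨ sym (+-identityʳ 1#) ⟩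
    1# + 0#     ≡⟨ cong (1# +_) (sym -1≡0) ⟩
    1# + - 1#   ≡⟨ -‿inverseʳ 1# ⟩
    0#          ∎))

  0*u+x≡x : ∀ u x → 0# * u + x ≡ x
  0*u+x≡x u x = trans (cong (_+ x) (zeroˡ u)) (+-identityˡ x)

  x+0*u≡x : ∀ x u → x + 0# * u ≡ x
  x+0*u≡x x u = trans (cong (x +_) (zeroˡ u)) (+-identityʳ x)

  x+a*u+-a*u≡x : ∀ x a u → x + a * u + - a * u ≡ x
  x+a*u+-a*u≡x x a u = begin
    x + a * u + - a * u    ≡⟨ +-assoc x _ _ ⟩
    x + (a * u + - a * u)  ≡⟨ cong (x +_) (sym (distribʳ u a (- a))) ⟩
    x + (a + - a) * u      ≡⟨ cong (λ c → x + c * u) (-‿inverseʳ a) ⟩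
    x + 0# * u             ≡⟨ x+0*u≡x x u ⟩
    x                      ∎

  x+-1*x≡0 : ∀ x → x + - 1# * x ≡ 0#
  x+-1*x≡0 x = begin
    x + - 1# * x              ≡⟨ cong (_+ - 1# * x) (sym (trans (+-identityˡ _) (*-identityˡ x))) ⟩
    0# + 1# * x + - 1# * x    ≡⟨ x+a*u+-a*u≡x 0# 1# x ⟩
    0#                        ∎

  +-*-interchange : ∀ x y a b u → (x + a * u) + (y + b * u) ≡ (x + y) + (a + b) * u
  +-*-interchange = solve 5 (λ x y a b u → (x :+ a :* u) :+ (y :+ b :* u) := (x :+ y) :+ (a :+ b) :* u) refl

  *-distrib-+-* : ∀ c x a u → c * (x + a * u) ≡ c * x + (c * a) * u
  *-distrib-+-* = solve 4 (λ c x a u → c :* (x :+ a :* u) := c :* x :+ (c :* a) :* u) refl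

  -- The semiring solver treats - a as an atom; a + - a ≈ 0 is applied by hand.
  x+-a*u+a*u≡x : ∀ x a u → x + - a * u + a * u ≡ x
  x+-a*u+a*u≡x x a u = trans (solve 4 (λ x a n u → x :+ n :* u :+ a :* u := x :+ a :* u :+ n :* u) refl x a (- a) u)
                            (x+a*u+-a*u≡x x a u)

  cancel-pivot : ∀ x a w p → (x + a * w) + - a * (p + w) ≡ x + - a * p
  cancel-pivot x a w p =
    trans (solve 5 (λ x a n w p → (x :+ a :* w) :+ n :* (p :+ w) := x :+ n :* p :+ a :* w :+ n :* w) refl x a (- a) w p)
          (x+a*u+-a*u≡x (x + - a * p) a w)

module PGProperties (F : FiniteField) (N : ℕ) where
  open FiniteField F
  open FiniteFieldProperties F
  open PG F N

  -- Spans of lists of vectors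

  infixl 6 _+ᵛ_
  infixr 7 _·ᵛ_
  infix 4 _∈⟨_⟩ _⊆⟨_⟩

  _+ᵛ_ : V → V → V
  (x +ᵛ y) t = x t + y t

  _·ᵛ_ : Carrier → V → V
  (a ·ᵛ x) t = a * x t

  ≈-sym : ∀ {x y} → x ≈ y → y ≈ x
  ≈-sym x≈y t = sym (x≈y t)

  _≈?_ : ∀ x y → Dec (x ≈ y)
  x ≈? y = Fin.all? (λ t → x t ≟ y t)

  -- Spans in elimination form: the coefficient of u is recorded and u removed.
  -- Over a finite field this makes membership decidable.
  _∈⟨_⟩ : V → List V → Set
  x ∈⟨ [] ⟩    = x ≈ 0v
  x ∈⟨ u ∷ U ⟩ = Σ Carrier λ a → x +ᵛ a ·ᵛ u ∈⟨ U ⟩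

  _⊆⟨_⟩ : List V → List V → Set
  U ⊆⟨ W ⟩ = All (_∈⟨ W ⟩) U

  ∈⟨⟩-resp-≈ : ∀ U {x y} → x ≈ y → x ∈⟨ U ⟩ → y ∈⟨ U ⟩
  ∈⟨⟩-resp-≈ []      x≈y x≈0       t = trans (sym (x≈y t)) (x≈0 t)
  ∈⟨⟩-resp-≈ (u ∷ U) x≈y (a , x′∈U) = a , ∈⟨⟩-resp-≈ U (λ t → cong (_+ a * u t) (x≈y t)) x′∈U

  0∈⟨⟩ : ∀ U → 0v ∈⟨ U ⟩
  0∈⟨⟩ []      t = refl
  0∈⟨⟩ (u ∷ U)   = 0# , ∈⟨⟩-resp-≈ U (λ t → sym (x+0*u≡x 0# (u t))) (0∈⟨⟩ U)

  ∈⟨⟩-+ : ∀ U {x y} → x ∈⟨ U ⟩ → y ∈⟨ U ⟩ → x +ᵛ y ∈⟨ U ⟩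
  ∈⟨⟩-+ []      x≈0 y≈0 t = trans (cong₂ _+_ (x≈0 t) (y≈0 t)) (+-identityʳ 0#)
  ∈⟨⟩-+ (u ∷ U) {x} {y} (a , x′∈U) (b , y′∈U) =
    a + b , ∈⟨⟩-resp-≈ U (λ t → +-*-interchange (x t) (y t) a b (u t)) (∈⟨⟩-+ U x′∈U y′∈U)

  ∈⟨⟩-· : ∀ U c {x} → x ∈⟨ U ⟩ → c ·ᵛ x ∈⟨ U ⟩
  ∈⟨⟩-· []      c x≈0 t = trans (cong (c *_) (x≈0 t)) (zeroʳ c)
  ∈⟨⟩-· (u ∷ U) c {x} (a , x′∈U) =
    c * a , ∈⟨⟩-resp-≈ U (λ t → *-distrib-+-* c (x t) a (u t)) (∈⟨⟩-· U c x′∈U)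

  ∈⟨∷⟩⁺ : ∀ {u} U {x} → x ∈⟨ U ⟩ → x ∈⟨ u ∷ U ⟩
  ∈⟨∷⟩⁺ {u} U {x} x∈U = 0# , ∈⟨⟩-resp-≈ U (λ t → sym (x+0*u≡x (x t) (u t))) x∈U

  u∈⟨u∷U⟩ : ∀ u U → u ∈⟨ u ∷ U ⟩
  u∈⟨u∷U⟩ u U = - 1# , ∈⟨⟩-resp-≈ U (λ t → sym (x+-1*x≡0 (u t))) (0∈⟨⟩ U)

  ∈⇒∈⟨⟩ : ∀ {U x} → x ∈ˡ U → x ∈⟨ U ⟩
  ∈⇒∈⟨⟩ {u ∷ U} (here refl)  = u∈⟨u∷U⟩ u U
  ∈⇒∈⟨⟩ {u ∷ U} (there x∈U) = ∈⟨∷⟩⁺ U (∈⇒∈⟨⟩ x∈U)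

  ⊆⇒⊆⟨⟩ : ∀ {U W} → U ⊆ˡ W → U ⊆⟨ W ⟩
  ⊆⇒⊆⟨⟩ U⊆W = All.tabulate (∈⇒∈⟨⟩ ∘ U⊆W)

  ∈⟨⟩-trans : ∀ {U W x} → U ⊆⟨ W ⟩ → x ∈⟨ U ⟩ → x ∈⟨ W ⟩
  ∈⟨⟩-trans {[]}    {W}     []           x≈0        = ∈⟨⟩-resp-≈ W (≈-sym x≈0) (0∈⟨⟩ W)
  ∈⟨⟩-trans {u ∷ U} {W} {x} (u∈W ∷ U⊆W) (a , x′∈U) =
    ∈⟨⟩-resp-≈ W (λ t → x+a*u+-a*u≡x (x t) a (u t))
      (∈⟨⟩-+ W (∈⟨⟩-trans U⊆W x′∈U) (∈⟨⟩-· W (- a) u∈W))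

  ⊆⟨⟩-trans : ∀ {U W X} → U ⊆⟨ W ⟩ → W ⊆⟨ X ⟩ → U ⊆⟨ X ⟩
  ⊆⟨⟩-trans U⊆W W⊆X = All.map (∈⟨⟩-trans W⊆X) U⊆W

  ∈⟨⟩? : ∀ U x → Dec (x ∈⟨ U ⟩)
  ∈⟨⟩? []      x = x ≈? 0v
  ∈⟨⟩? (u ∷ U) x = ∃? (λ a → ∈⟨⟩? U (x +ᵛ a ·ᵛ u))

  Independent : List V → Set
  Independent []      = ⊤
  Independent (u ∷ U) = ¬ u ∈⟨ U ⟩ × Independent U

  independent? : ∀ U → Dec (Independent U)
  independent? []      = yes tt
  independent? (u ∷ U) = ¬? (∈⟨⟩? U u) ×-dec independent? U

  independent-remove : ∀ A {v U} → Independent (A ++ v ∷ U) → Independent (A ++ U)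
  independent-remove []      (_ , indU)         = indU
  independent-remove (a ∷ A) {v} {U} (a∉ , ind) =
    (λ a∈ → a∉ (∈⟨⟩-trans (⊆⇒⊆⟨⟩ skip) a∈)) , independent-remove A ind
    where
    skip : A ++ U ⊆ˡ A ++ v ∷ U
    skip x∈ with ∈-++⁻ A x∈
    ... | inj₁ x∈A = ∈-++⁺ˡ x∈A
    ... | inj₂ x∈U = ∈-++⁺ʳ A (there x∈U)

  pointwise⇒⊆⟨⟩ : ∀ {U W} → Pointwise _≈_ U W → U ⊆⟨ W ⟩
  pointwise⇒⊆⟨⟩ []                        = []
  pointwise⇒⊆⟨⟩ {W = w ∷ W} (u≈w ∷ U≈W) =
    ∈⟨⟩-resp-≈ _ (≈-sym u≈w) (u∈⟨u∷U⟩ w W) ∷ All.map (∈⟨∷⟩⁺ W) (pointwise⇒⊆⟨⟩ U≈W)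

  independent-resp-≈ : ∀ {U W} → Pointwise _≈_ U W → Independent W → Independent U
  independent-resp-≈ []                         _            = tt
  independent-resp-≈ {W = _ ∷ W} (u≈w ∷ U≈W) (w∉W , indW) =
    (λ u∈U → w∉W (∈⟨⟩-resp-≈ W u≈w (∈⟨⟩-trans (pointwise⇒⊆⟨⟩ U≈W) u∈U)))
    , independent-resp-≈ U≈W indW

  -- Dimension

  -- Gaussian elimination of w: a vector of U with nonzero w-coordinate is rescaled
  -- into a pivot p (p + w ∈ ⟨ W ⟩); subtracting multiples of p from the others
  -- leaves length U - 1 independent vectors in ⟨ W ⟩.
  record Pivot (w : V) (W U : List V) : Set where
    field
      pivot               : V
      pivot+w∈W           : pivot +ᵛ w ∈⟨ W ⟩
      pivot∈U             : pivot ∈⟨ U ⟩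
      reduced             : List V
      reduced-independent : Independent reduced
      reduced⊆W           : reduced ⊆⟨ W ⟩
      reduced⊆U           : reduced ⊆⟨ U ⟩
      reduced-length      : suc (length reduced) ≡ length U

  eliminate : ∀ w W U → Independent U → U ⊆⟨ w ∷ W ⟩ → U ⊆⟨ W ⟩ ⊎ Pivot w W U
  eliminate w W []      _            []                     = inj₁ []
  eliminate w W (u ∷ U) (u∉U , indU) ((a , u+aw∈W) ∷ U⊆wW) with eliminate w W U indU U⊆wW
  ... | inj₂ piv = inj₂ reduce
    where
    open Pivot piv
    u′ : V
    u′ = u +ᵛ - a ·ᵛ pivot
    u′∈W : u′ ∈⟨ W ⟩
    u′∈W = ∈⟨⟩-resp-≈ W (λ t → cancel-pivot (u t) a (w t) (pivot t)) (∈⟨⟩-+ W u+aw∈W (∈⟨⟩-· W (- a) pivot+w∈W))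
    u′∉reduced : ¬ u′ ∈⟨ reduced ⟩
    u′∉reduced u′∈ = u∉U (∈⟨⟩-resp-≈ U (λ t → x+-a*u+a*u≡x (u t) a (pivot t))
                                 (∈⟨⟩-+ U (∈⟨⟩-trans reduced⊆U u′∈) (∈⟨⟩-· U a pivot∈U)))
    reduce : Pivot w W (u ∷ U)
    reduce = record
      { pivot               = pivot
      ; pivot+w∈W           = pivot+w∈W
      ; pivot∈U             = ∈⟨∷⟩⁺ U pivot∈U
      ; reduced             = u′ ∷ reduced
      ; reduced-independent = u′∉reduced , reduced-independent
      ; reduced⊆W           = u′∈W ∷ reduced⊆W
      ; reduced⊆U           = ∈⟨⟩-+ (u ∷ U) (u∈⟨u∷U⟩ u U) (∈⟨⟩-· (u ∷ U) (- a) (∈⟨∷⟩⁺ U pivot∈U))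
                              ∷ All.map (∈⟨∷⟩⁺ U) reduced⊆U
      ; reduced-length      = cong suc reduced-length
      }
  ... | inj₁ U⊆W with a ≟ 0#
  ...   | yes refl = inj₁ (∈⟨⟩-resp-≈ W (λ t → x+0*u≡x (u t) (w t)) u+aw∈W ∷ U⊆W)
  ...   | no a≢0   = inj₂ record
      { pivot               = b ·ᵛ u
      ; pivot+w∈W           = ∈⟨⟩-resp-≈ W scaled (∈⟨⟩-· W b u+aw∈W)
      ; pivot∈U             = ∈⟨⟩-· (u ∷ U) b (u∈⟨u∷U⟩ u U)
      ; reduced             = U
      ; reduced-independent = indU
      ; reduced⊆W           = U⊆W
      ; reduced⊆U           = ⊆⇒⊆⟨⟩ there
      ; reduced-length      = refl
      }
    where
    b : Carrier
    b = proj₁ (inverse a a≢0)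
    scaled : (b ·ᵛ (u +ᵛ a ·ᵛ w)) ≈ (b ·ᵛ u +ᵛ w)
    scaled t = begin
      b * (u t + a * w t)    ≡⟨ *-distrib-+-* b (u t) a (w t) ⟩
      b * u t + b * a * w t  ≡⟨ cong (λ c → b * u t + c * w t) (trans (*-comm b a) (proj₂ (inverse a a≢0))) ⟩
      b * u t + 1# * w t     ≡⟨ cong (b * u t +_) (*-identityˡ (w t)) ⟩
      b * u t + w t          ∎
      where open ≡-Reasoning

  independent-length-≤ : ∀ W {U} → Independent U → U ⊆⟨ W ⟩ → length U ≤ length W
  independent-length-≤ []      {[]}    _          _             = z≤n
  independent-length-≤ []      {u ∷ U} (u∉U , _) (u≈0 ∷ _)     = ⊥-elim (u∉U (∈⟨⟩-resp-≈ U (≈-sym u≈0) (0∈⟨⟩ U)))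
  independent-length-≤ (w ∷ W) {U}     indU       U⊆wW with eliminate w W U indU U⊆wW
  ... | inj₁ U⊆W = m≤n⇒m≤1+n (independent-length-≤ W indU U⊆W)
  ... | inj₂ piv = subst (_≤ suc (length W)) reduced-length (s≤s (independent-length-≤ W reduced-independent reduced⊆W))
    where open Pivot piv

  basis-length-unique : ∀ {U W} → Independent U → Independent W → U ⊆⟨ W ⟩ → W ⊆⟨ U ⟩ → length U ≡ length W
  basis-length-unique {U} {W} indU indW U⊆W W⊆U = ≤-antisym (independent-length-≤ W indU U⊆W) (independent-length-≤ U indW W⊆U)

  record Extension (U L : List V) : Set where
    field
      added       : List V
      independent : Independent (added ++ U)
      spans       : L ⊆⟨ added ++ U ⟩
      added⊆L     : added ⊆ˡ L

  extend : ∀ {U} → Independent U → ∀ L → Extension U L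
  extend indU [] = record { added = [] ; independent = indU ; spans = [] ; added⊆L = λ () }
  extend {U} indU (y ∷ L) with extend indU L
  ... | E with ∈⟨⟩? (Extension.added E ++ U) y
  ...   | yes y∈ = record
      { added       = added
      ; independent = independent
      ; spans       = y∈ ∷ spans
      ; added⊆L     = there ∘ added⊆L
      }
    where open Extension E
  ...   | no y∉ = record
      { added       = y ∷ added
      ; independent = y∉ , independent
      ; spans       = u∈⟨u∷U⟩ y (added ++ U) ∷ All.map (∈⟨∷⟩⁺ (added ++ U)) spans
      ; added⊆L     = λ { (here refl) → here refl ; (there x∈) → there (added⊆L x∈) }
      }
    where open Extension E

  basisOf : ∀ P → Σ (List V) λ B → Independent B × P ⊆⟨ B ⟩ × B ⊆ˡ P
  basisOf P = added , subst Independent (++-identityʳ added) independent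
                    , subst (P ⊆⟨_⟩) (++-identityʳ added) spans , added⊆L
    where open Extension (extend tt P)

  -- Extend a basis B of ⟨ P ⟩ by v, then by L, to a basis of ⟨ L ⟩; dropping v
  -- leaves a basis one shorter whose span still contains P.
  codim1-cover : ∀ {L P v} → Independent L → P ⊆⟨ L ⟩ → v ∈⟨ L ⟩ → ¬ v ∈⟨ P ⟩ →
                 Σ (List V) λ Λ → Independent Λ × suc (length Λ) ≡ length L × P ⊆⟨ Λ ⟩ × Λ ⊆⟨ L ⟩
  codim1-cover {L} {P} {v} indL P⊆L v∈L v∉P with basisOf P
  ... | B , indB , P⊆B , B⊆P =
    added ++ B , independent-remove added independent , length-Λ
               , ⊆⟨⟩-trans P⊆B (⊆⇒⊆⟨⟩ (∈-++⁺ʳ added)) , ++⁺ (⊆⇒⊆⟨⟩ added⊆L) B⊆L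
    where
    B⊆L : B ⊆⟨ L ⟩
    B⊆L = ⊆⟨⟩-trans (⊆⇒⊆⟨⟩ B⊆P) P⊆L
    v∉B : ¬ v ∈⟨ B ⟩
    v∉B = v∉P ∘ ∈⟨⟩-trans (⊆⇒⊆⟨⟩ B⊆P)
    open Extension (extend (v∉B , indB) L)
    open ≡-Reasoning
    length-Λ : suc (length (added ++ B)) ≡ length L
    length-Λ = begin
      suc (length (added ++ B))          ≡⟨ cong suc (length-++ added) ⟩
      suc (length added Nat.+ length B)  ≡⟨ sym (+-suc (length added) (length B)) ⟩
      length added Nat.+ length (v ∷ B)  ≡⟨ sym (length-++ added) ⟩
      length (added ++ v ∷ B)            ≡⟨ basis-length-unique independent indL (++⁺ (⊆⇒⊆⟨⟩ added⊆L) (v∈L ∷ B⊆L)) spans ⟩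
      length L                           ∎

  -- Subspaces given by a basis

  basisList : ∀ {k} → Subspace k → List V
  basisList W = tabulate (Subspace.basis W)

  lc∈⟨tabulate⟩ : ∀ k c (b : Fin k → V) → lc k c b ∈⟨ tabulate b ⟩
  lc∈⟨tabulate⟩ zero    c b t = refl
  lc∈⟨tabulate⟩ (suc k) c b =
    - c zero , ∈⟨⟩-resp-≈ (tabulate (b ∘ suc)) (λ t → sym (cancel t)) (lc∈⟨tabulate⟩ k (c ∘ suc) (b ∘ suc))
    where
    cancel : ∀ t → lc (suc k) c b t + - c zero * b zero t ≡ lc k (c ∘ suc) (b ∘ suc) t
    cancel t = trans (cong (_+ - c zero * b zero t) (+-comm _ _)) (x+a*u+-a*u≡x _ (c zero) (b zero t))

  ∈⟨tabulate⟩⇒lc : ∀ k (b : Fin k → V) {x} → x ∈⟨ tabulate b ⟩ → Σ (Fin k → Carrier) λ c → x ≈ lc k c b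
  ∈⟨tabulate⟩⇒lc zero    b x≈0 = (λ ()) , x≈0
  ∈⟨tabulate⟩⇒lc (suc k) b {x} (a , x′∈) with ∈⟨tabulate⟩⇒lc k (b ∘ suc) x′∈
  ... | c , x′≈lc = (- a) Vector.∷ c , λ t → begin
    x t                                    ≡⟨ sym (x+a*u+-a*u≡x (x t) a (b zero t)) ⟩
    x t + a * b zero t + - a * b zero t    ≡⟨ cong (_+ - a * b zero t) (x′≈lc t) ⟩
    lc k c (b ∘ suc) t + - a * b zero t    ≡⟨ +-comm _ _ ⟩
    - a * b zero t + lc k c (b ∘ suc) t    ∎
    where open ≡-Reasoning

  ∈⇒∈⟨basis⟩ : ∀ {k} (W : Subspace k) {v} → v ∈ W → v ∈⟨ basisList W ⟩
  ∈⇒∈⟨basis⟩ W (c , v≈lc) = ∈⟨⟩-resp-≈ (basisList W) (≈-sym v≈lc) (lc∈⟨tabulate⟩ _ c (Subspace.basis W))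

  ∈⟨basis⟩⇒∈ : ∀ {k} (W : Subspace k) {v} → v ∈⟨ basisList W ⟩ → v ∈ W
  ∈⟨basis⟩⇒∈ W = ∈⟨tabulate⟩⇒lc _ (Subspace.basis W)

  linIndep⇒independent : ∀ k (b : Fin k → V) → LinIndep k b → Independent (tabulate b)
  linIndep⇒independent zero    b _   = tt
  linIndep⇒independent (suc k) b ind = b₀∉ , linIndep⇒independent k (b ∘ suc) ind′
    where
    ind′ : LinIndep k (b ∘ suc)
    ind′ c lc≈0 i = ind (0# Vector.∷ c) (λ t → trans (0*u+x≡x (b zero t) _) (lc≈0 t)) (suc i)
    b₀∉ : ¬ b zero ∈⟨ tabulate (b ∘ suc) ⟩
    b₀∉ b₀∈ with ∈⟨tabulate⟩⇒lc k (b ∘ suc) b₀∈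
    ... | c , b₀≈lc = -1≢0 (ind (- 1# Vector.∷ c) dependence zero)
      where
      dependence : lc (suc k) (- 1# Vector.∷ c) b ≈ 0v
      dependence t = trans (cong (- 1# * b zero t +_) (sym (b₀≈lc t))) (trans (+-comm _ _) (x+-1*x≡0 (b zero t)))

  independent⇒linIndep : ∀ k (b : Fin k → V) → Independent (tabulate b) → LinIndep k b
  independent⇒linIndep zero    b _            c _     ()
  independent⇒linIndep (suc k) b (b₀∉ , ind) c lc≈0 with c zero ≟ 0#
  ... | yes c₀≡0 = coefficient≡0
    where
    rest≈0 : lc k (c ∘ suc) (b ∘ suc) ≈ 0v
    rest≈0 t = trans (sym (trans (cong (λ a → a * b zero t + lc k (c ∘ suc) (b ∘ suc) t) c₀≡0) (0*u+x≡x (b zero t) _))) (lc≈0 t)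
    coefficient≡0 : ∀ i → c i ≡ 0#
    coefficient≡0 zero    = c₀≡0
    coefficient≡0 (suc i) = independent⇒linIndep k (b ∘ suc) ind (c ∘ suc) rest≈0 i
  ... | no c₀≢0 = ⊥-elim (b₀∉ (∈⟨⟩-resp-≈ _ solved (∈⟨⟩-+ _ (∈⟨⟩-· _ d lc∈) (∈⟨⟩-· _ (- d) r∈))))
    where
    d : Carrier
    d = proj₁ (inverse (c zero) c₀≢0)
    r : V
    r = lc k (c ∘ suc) (b ∘ suc)
    r∈ : r ∈⟨ tabulate (b ∘ suc) ⟩
    r∈ = lc∈⟨tabulate⟩ k (c ∘ suc) (b ∘ suc)
    lc∈ : lc (suc k) c b ∈⟨ tabulate (b ∘ suc) ⟩
    lc∈ = ∈⟨⟩-resp-≈ _ (≈-sym lc≈0) (0∈⟨⟩ _)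
    solved : (d ·ᵛ lc (suc k) c b +ᵛ - d ·ᵛ r) ≈ b zero
    solved t = begin
      d * (c zero * b zero t + r t) + - d * r t   ≡⟨ cong (_+ - d * r t) (distribˡ d _ (r t)) ⟩
      d * (c zero * b zero t) + d * r t + - d * r t ≡⟨ x+a*u+-a*u≡x _ d (r t) ⟩
      d * (c zero * b zero t)                       ≡⟨ sym (*-assoc d (c zero) (b zero t)) ⟩
      d * c zero * b zero t                         ≡⟨ cong (_* b zero t) (trans (*-comm d (c zero)) (proj₂ (inverse (c zero) c₀≢0))) ⟩
      1# * b zero t                                 ≡⟨ *-identityˡ (b zero t) ⟩
      b zero t                                      ∎
      where open ≡-Reasoning

  basis-independent : ∀ {k} (W : Subspace k) → Independent (basisList W)
  basis-independent {k} W = linIndep⇒independent k (Subspace.basis W) (Subspace.indep W)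

  fromIndependent : ∀ {k} U → Independent U → length U ≡ k → Subspace k
  fromIndependent U indU refl = record
    { basis = lookup U
    ; indep = independent⇒linIndep (length U) (lookup U) (subst Independent (sym (tabulate-lookup U)) indU)
    }

  basisList-fromIndependent : ∀ {k} U indU (eq : length U ≡ k) → basisList (fromIndependent U indU eq) ≡ U
  basisList-fromIndependent U indU refl = tabulate-lookup U

  ∈⟨⟩⇒∈-fromIndependent : ∀ {k U indU} (eq : length U ≡ k) {v} → v ∈⟨ U ⟩ → v ∈ fromIndependent U indU eq
  ∈⟨⟩⇒∈-fromIndependent {U = U} {indU} eq {v} =
    ∈⟨basis⟩⇒∈ (fromIndependent U indU eq) ∘ subst (v ∈⟨_⟩) (sym (basisList-fromIndependent U indU eq))

  ∈-fromIndependent⇒∈⟨⟩ : ∀ {k U indU} (eq : length U ≡ k) {v} → v ∈ fromIndependent U indU eq → v ∈⟨ U ⟩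
  ∈-fromIndependent⇒∈⟨⟩ {U = U} {indU} eq {v} =
    subst (v ∈⟨_⟩) (basisList-fromIndependent U indU eq) ∘ ∈⇒∈⟨basis⟩ (fromIndependent U indU eq)

  unit : Fin (suc N) → V
  unit s t with s Fin.≟ t
  ... | yes _ = 1#
  ... | no _  = 0#

  ∈⟨units⟩ : ∀ {k} (g : Fin k → Fin (suc N)) x → (∀ t → (∀ i → g i ≢ t) → x t ≡ 0#) →
             x ∈⟨ tabulate (unit ∘ g) ⟩
  ∈⟨units⟩ {zero}  g x vanishes t = vanishes t (λ ())
  ∈⟨units⟩ {suc k} g x vanishes   = - x (g zero) , ∈⟨units⟩ (g ∘ suc) _ vanishes′
    where
    vanishes′ : ∀ t → (∀ i → g (suc i) ≢ t) → x t + - x (g zero) * unit (g zero) t ≡ 0#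
    vanishes′ t t∉g with g zero Fin.≟ t
    ... | yes refl = trans (cong (x t +_) (*-identityʳ _)) (-‿inverseʳ (x t))
    ... | no g₀≢t  = trans (trans (cong (x t +_) (zeroʳ _)) (+-identityʳ (x t)))
                           (vanishes t λ { zero → g₀≢t ; (suc i) → t∉g i })

  independent-length-≤-dimension : ∀ {U} → Independent U → length U ≤ suc N
  independent-length-≤-dimension {U} indU =
    subst (length U ≤_) (length-tabulate unit)
          (independent-length-≤ (tabulate unit) indU (All.tabulate (λ _ → ∈⟨units⟩ id _ λ t t∉ → ⊥-elim (t∉ t refl))))

  lc-nonzero : ∀ {k} (W : Subspace k) c i → c i ≡ 1# → NonZero (lc k c (Subspace.basis W))
  lc-nonzero W c i cᵢ≡1 lc≈0 = 0≢1 (trans (sym (Subspace.indep W c lc≈0 i)) cᵢ≡1)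

  hyperplane-meets-line : (H : Hyperplane) (ℓ : Line) → Meets ℓ H
  hyperplane-meets-line H ℓ = meet (∈⟨⟩? L a₀) (∈⟨⟩? (a₀ ∷ L) a₁)
    where
    open Subspace ℓ using (basis)
    L : List V
    L = basisList H
    a₀ a₁ : V
    a₀ = basis zero
    a₁ = basis (suc zero)
    meetsAt : ∀ c i → c i ≡ 1# → lc 2 c basis ∈⟨ L ⟩ → Meets ℓ H
    meetsAt c i cᵢ≡1 p∈L = lc 2 c basis , lc-nonzero ℓ c i cᵢ≡1 , (c , λ _ → refl) , ∈⟨basis⟩⇒∈ H p∈L
    meet : Dec (a₀ ∈⟨ L ⟩) → Dec (a₁ ∈⟨ a₀ ∷ L ⟩) → Meets ℓ H
    meet (yes a₀∈L) _ = meetsAt (1# Vector.∷ 0# Vector.∷ Vector.[]) zero refl (∈⟨⟩-resp-≈ L p≈a₀ a₀∈L)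
      where
      p≈a₀ : a₀ ≈ lc 2 (1# Vector.∷ 0# Vector.∷ Vector.[]) basis
      p≈a₀ t = sym (trans (cong₂ _+_ (*-identityˡ (a₀ t)) (trans (+-identityʳ _) (zeroˡ (a₁ t)))) (+-identityʳ (a₀ t)))
    meet (no _) (yes (α , a₁+αa₀∈L)) = meetsAt (α Vector.∷ 1# Vector.∷ Vector.[]) (suc zero) refl (∈⟨⟩-resp-≈ L p≈ a₁+αa₀∈L)
      where
      p≈ : (a₁ +ᵛ α ·ᵛ a₀) ≈ lc 2 (α Vector.∷ 1# Vector.∷ Vector.[]) basis
      p≈ t = sym (trans (cong (α * a₀ t +_) (trans (+-identityʳ _) (*-identityˡ (a₁ t)))) (+-comm _ _))
    meet (no a₀∉L) (no a₁∉) = ⊥-elim (1+n≰n (subst (λ n → suc (suc n) ≤ suc N) (length-tabulate (Subspace.basis H))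
                                       (independent-length-≤-dimension (a₁∉ , a₀∉L , basis-independent H))))

  section⊆⇒meets : ∀ {k} (H : Hyperplane) (W : Subspace k) (ℓ : Line) →
                   (∀ w → NonZero w → w ∈ ℓ → w ∈ H → w ∈ W) → Meets ℓ W
  section⊆⇒meets H W ℓ section⊆W with hyperplane-meets-line H ℓ
  ... | w , w≢0 , w∈ℓ , w∈H = w , w≢0 , w∈ℓ , section⊆W w w≢0 w∈ℓ w∈H

  ∈⟨⟩⇒InSpan : ∀ {P : V → Set} {U x} → All P U → x ∈⟨ U ⟩ → InSpan P x
  ∈⟨⟩⇒InSpan {U = U} PU x∈U with ∈⟨tabulate⟩⇒lc (length U) (lookup U) (subst (_ ∈⟨_⟩) (sym (tabulate-lookup U)) x∈U)
  ... | c , x≈lc = length U , c , lookup U , (λ i → All.lookup PU (∈-lookup i)) , x≈lc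

  ∈-resp-≈ : ∀ {k} (W : Subspace k) {v w} → v ≈ w → v ∈ W → w ∈ W
  ∈-resp-≈ W v≈w (c , v≈lc) = c , λ t → trans (sym (v≈w t)) (v≈lc t)

  ∈? : ∀ {k} (W : Subspace k) v → Dec (v ∈ W)
  ∈? W v = map′ (∈⟨basis⟩⇒∈ W) (∈⇒∈⟨basis⟩ W) (∈⟨⟩? (basisList W) v)

  nonzero-⊆⇒⊆ : ∀ {k l} (W : Subspace k) (W′ : Subspace l) → (∀ v → NonZero v → v ∈ W → v ∈ W′) → W ⊆ W′
  nonzero-⊆⇒⊆ W W′ sub v v∈W with v ≈? 0v
  ... | yes v≈0 = ∈-resp-≈ W′ (≈-sym v≈0) (∈⟨basis⟩⇒∈ W′ (0∈⟨⟩ (basisList W′)))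
  ... | no  v≢0 = sub v v≢0 v∈W

  unionOfLines? : ∀ {m} (ℓ : Fin m → Line) {I : Fin m → Set} → Decidable I → Decidable (UnionOfLines ℓ I)
  unionOfLines? ℓ I? v = ¬? (v ≈? 0v) ×-dec Fin.any? (λ i → I? i ×-dec ∈? (ℓ i) v)

  unionOfLines-resp-≈ : ∀ {m} (ℓ : Fin m → Line) {I : Fin m → Set} {v w} →
                        v ≈ w → UnionOfLines ℓ I v → UnionOfLines ℓ I w
  unionOfLines-resp-≈ ℓ v≈w (v≢0 , i , Iᵢ , v∈ℓᵢ) =
    (λ w≈0 → v≢0 (λ t → trans (v≈w t) (w≈0 t))) , i , Iᵢ , ∈-resp-≈ (ℓ i) v≈w v∈ℓᵢ

  -- Cutting blocking sets

  vectors : ∀ k → List (Fin k → Carrier)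
  vectors zero    = Vector.[] ∷ []
  vectors (suc k) = cartesianProductWith Vector._∷_ elements (vectors k)

  vectors-complete : ∀ k (x : Fin k → Carrier) → Σ (Fin k → Carrier) λ y → y ∈ˡ vectors k × y ≗ x
  vectors-complete zero    x = Vector.[] , here refl , λ ()
  vectors-complete (suc k) x with vectors-complete k (x ∘ suc)
  ... | y , y∈ , y≗x = x zero Vector.∷ y , ∈-cartesianProductWith⁺ Vector._∷_ (∈-elements (x zero)) y∈
                     , λ { zero → refl ; (suc i) → y≗x i }

  lists : ℕ → List (List V)
  lists zero    = [] ∷ []
  lists (suc k) = cartesianProductWith _∷_ (vectors (suc N)) (lists k)

  lists-complete : ∀ {k} (b : Fin k → V) → Σ (List V) λ L → L ∈ˡ lists k × Pointwise _≈_ L (tabulate b)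
  lists-complete {zero}  b = [] , here refl , []
  lists-complete {suc k} b with vectors-complete (suc N) (b zero) | lists-complete (b ∘ suc)
  ... | y , y∈ , y≈b₀ | L , L∈ , L≈ = y ∷ L , ∈-cartesianProductWith⁺ _∷_ y∈ L∈ , y≈b₀ ∷ L≈

  module NonCutting {S : V → Set} (S? : Decidable S) (S-resp : ∀ {v w} → v ≈ w → S v → S w) where

    S∩⟨_⟩? : ∀ L → Decidable (λ w → S w × w ∈⟨ L ⟩)
    S∩⟨ L ⟩? w = S? w ×-dec ∈⟨⟩? L w

    -- S ∩ ⟨ L ⟩ as a finite list, complete up to ≈.
    inside : List V → List V
    inside L = filter S∩⟨ L ⟩? (vectors (suc N))

    inside-sound : ∀ {L w} → w ∈ˡ inside L → S w × w ∈⟨ L ⟩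
    inside-sound {L} w∈ = proj₂ (∈-filter⁻ S∩⟨ L ⟩? {xs = vectors (suc N)} w∈)

    inside-complete : ∀ {L w} → S w → w ∈⟨ L ⟩ → w ∈⟨ inside L ⟩
    inside-complete {L} {w} Sw w∈L with vectors-complete (suc N) w
    ... | y , y∈ , y≈w = ∈⟨⟩-resp-≈ (inside L) y≈w (∈⇒∈⟨⟩ (∈-filter⁺ S∩⟨ L ⟩? y∈
                           (S-resp (≈-sym y≈w) Sw , ∈⟨⟩-resp-≈ L (≈-sym y≈w) w∈L)))

    inside⊆⟨⟩ : ∀ L → inside L ⊆⟨ L ⟩
    inside⊆⟨⟩ L = All.tabulate (proj₂ ∘ inside-sound)

    -- CuttingBlocking quantifies over all hyperplanes; a hyperplane where it fails
    -- is found by searching the finitely many candidate bases in lists N.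
    UncutBasis : List V → Set
    UncutBasis L = Independent L × length L ≡ N × ¬ L ⊆⟨ inside L ⟩

    uncutBasis? : ∀ L → Dec (UncutBasis L)
    uncutBasis? L = independent? L ×-dec (length L Nat.≟ N) ×-dec ¬? (all? (∈⟨⟩? (inside L)) L)

    noUncutBasis⇒cutting : ¬ Any UncutBasis (lists N) → CuttingBlocking S
    noUncutBasis⇒cutting noUncut H v v∈H with lists-complete (Subspace.basis H)
    ... | L , L∈ , L≈basis = ∈⟨⟩⇒InSpan inside⊆S∩H v∈inside
      where
      L-length : length L ≡ N
      L-length = trans (Pointwise-length L≈basis) (length-tabulate (Subspace.basis H))
      L⊆inside : L ⊆⟨ inside L ⟩
      L⊆inside = decidable-stable (all? (∈⟨⟩? (inside L)) L)
                   λ L⊈ → noUncut (lose L∈ (independent-resp-≈ L≈basis (basis-independent H) , L-length , L⊈))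
      v∈inside : v ∈⟨ inside L ⟩
      v∈inside = ∈⟨⟩-trans L⊆inside (∈⟨⟩-trans (pointwise⇒⊆⟨⟩ (symmetric ≈-sym L≈basis)) (∈⇒∈⟨basis⟩ H v∈H))
      inside⊆S∩H : All (λ w → S w × w ∈ H) (inside L)
      inside⊆S∩H = All.tabulate λ w∈ → proj₁ (inside-sound w∈)
                                      , ∈⟨basis⟩⇒∈ H (∈⟨⟩-trans (pointwise⇒⊆⟨⟩ L≈basis) (proj₂ (inside-sound w∈)))

    uncutBasis : ¬ CuttingBlocking S → Σ (List V) UncutBasis
    uncutBasis notCutting with any? uncutBasis? (lists N)
    ... | yes someUncut = let (L , _ , uncut) = find someUncut in L , uncut
    ... | no  noUncut   = contradiction (noUncutBasis⇒cutting noUncut) notCutting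

    nonCutting⇒codim2 : ¬ CuttingBlocking S →
                        Σ Codim2 λ Λ → Σ Hyperplane λ H → Λ ⊆ H × (∀ w → S w → w ∈ H → w ∈ Λ)
    nonCutting⇒codim2 notCutting with uncutBasis notCutting
    ... | L , indL , L-length , L⊈inside with find (¬All⇒Any¬ (∈⟨⟩? (inside L)) L L⊈inside)
    ...   | v , v∈L , v∉inside with codim1-cover indL (inside⊆⟨⟩ L) (∈⇒∈⟨⟩ v∈L) v∉inside
    ...     | Λl , indΛ , Λ-length , inside⊆Λ , Λ⊆L = Λ , H , Λ⊆H , S∩H⊆Λ
      where
      Λ-length′ : length Λl ≡ N ∸ 1
      Λ-length′ = cong (_∸ 1) (trans Λ-length L-length)
      H : Hyperplane
      H = fromIndependent L indL L-length
      Λ : Codim2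
      Λ = fromIndependent Λl indΛ Λ-length′
      Λ⊆H : Λ ⊆ H
      Λ⊆H w w∈Λ = ∈⟨⟩⇒∈-fromIndependent L-length (∈⟨⟩-trans Λ⊆L (∈-fromIndependent⇒∈⟨⟩ Λ-length′ w∈Λ))
      S∩H⊆Λ : ∀ w → S w → w ∈ H → w ∈ Λ
      S∩H⊆Λ w Sw w∈H = ∈⟨⟩⇒∈-fromIndependent Λ-length′
                          (∈⟨⟩-trans inside⊆Λ (inside-complete Sw (∈-fromIndependent⇒∈⟨⟩ L-length w∈H)))

  codim2-through-lines : ∀ {m} (ℓ : Fin m → Line) {I : Fin m → Set} → Decidable I →
    ¬ CuttingBlocking (UnionOfLines ℓ I) →
    Σ Codim2 λ Λ → (∀ i → I i → Meets (ℓ i) Λ) ×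
      Σ Hyperplane λ H → Λ ⊆ H × (∀ i → I i → ℓ i ⊆ H → ℓ i ⊆ Λ)
  codim2-through-lines ℓ {I} I? notCutting =
    let Λ , H , Λ⊆H , S∩H⊆Λ = nonCutting⇒codim2 notCutting
        section⊆Λ : ∀ i → I i → ∀ w → NonZero w → w ∈ ℓ i → w ∈ H → w ∈ Λ
        section⊆Λ i Iᵢ w w≢0 w∈ℓᵢ = S∩H⊆Λ w (w≢0 , i , Iᵢ , w∈ℓᵢ)
    in Λ , (λ i Iᵢ → section⊆⇒meets H Λ (ℓ i) (section⊆Λ i Iᵢ)) , H , Λ⊆H
         , (λ i Iᵢ ℓᵢ⊆H → nonzero-⊆⇒⊆ (ℓ i) Λ λ w w≢0 w∈ℓᵢ → section⊆Λ i Iᵢ w w≢0 w∈ℓᵢ (ℓᵢ⊆H w w∈ℓᵢ))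
    where open NonCutting {S = UnionOfLines ℓ I} (unionOfLines? ℓ I?) (unionOfLines-resp-≈ ℓ)

proposition3p14 : (F : FiniteField) (N m : ℕ) (ℓ : Fin m → PG.Line F N) →
    (∀ i j → ¬ (i ≡ j) → ¬ (PG._⊆_ F N (ℓ i) (ℓ j) × PG._⊆_ F N (ℓ j) (ℓ i))) →
    PG.CuttingBlocking F N (PG.UnionOfLines F N ℓ (λ _ → ⊤)) →
    (∀ j → ¬ PG.CuttingBlocking F N (PG.UnionOfLines F N ℓ (λ i → ¬ (i ≡ j)))) →
    ∀ j → Σ (PG.Codim2 F N) λ Λ →
      (∀ i → ¬ (i ≡ j) → PG.Meets F N (ℓ i) Λ) ×
      Σ (PG.Hyperplane F N) λ H →
        PG._⊆_ F N Λ H ×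
        (∀ i → ¬ (i ≡ j) → PG._⊆_ F N (ℓ i) H → PG._⊆_ F N (ℓ i) Λ)
proposition3p14 F N m ℓ _ _ minimal j =
  PGProperties.codim2-through-lines F N ℓ (λ i → ¬? (i Fin.≟ j)) (minimal j)
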